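{- Let $H=(V,E)$ be a graph with $m=|E|$ edges, fix an orientation $\overrightarrow{H}$ of $H$, and let $\rho=(\rho_{00},\rho_{01},\rho_{10},\rho_{11})\in[0,1]^4$. Let $(H_6,\pi)$ be the probabilistic graph where $H_6=\mathrm{sub}(H,6)$ and, for each directed edge $(x,y)$ of $\overrightarrow{H}$, the path $x - v_1 - v_2 - v_3 - v_4 - v_5 - y$ replacing it receives edge probabilities $1/2,\rho_{00},\rho_{01},\rho_{10},\rho_{11},1/2$ in this order. Writing $\Lambda_{bb'}=\Pi^{bb'}_4(\rho)$, we have $$2^{2m}\cdot\Pr_{\mathrm{matching}}(H_6,\pi)=\sum_{\tau\in[m+1]^4}|S_\tau|\,\Lambda_{00}^{\tau_{00}}\Lambda_{01}^{\tau_{01}}\Lambda_{10}^{\tau_{10}}\Lambda_{11}^{\tau_{11}}.$$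
   Context: Graphs are finite, simple, undirected; a matching is a set of pairwise disjoint edges. $\mathrm{sub}(H,6)$ replaces each edge $\{x,y\}$ by a path of length $6$ with fresh intermediate vertices. For a probabilistic graph $(G,\pi)$ (edges kept independently with probability $\pi(e)$), $\Pr_{\mathrm{matching}}(G,\pi)=\sum_M\prod_{e\in M}\pi(e)\prod_{e\notin M}(1-\pi(e))$ over matchings $M$ of $G$. For $\rho\in[0,1]^n$, $\Pi_n(\rho)$ is this probability on the path of $n$ edges with probabilities $\rho_0,\ldots,\rho_{n-1}$, and $\Pi^{bb'}_n(\rho)=\Pi_{n+2}(b,\rho,b')$. $[m+1]=\{0,\ldots,m\}$ and $\tau\in[m+1]^4$ is indexed as $(\tau_{00},\tau_{01},\tau_{10},\tau_{11})$. An orientation $\overrightarrow{H}$ chooses one direction per edge. A selection function maps each vertex $x$ to a subset of size at most one of the edges incident to $x$; w.r.t. a selection function $\mu$, a directed edge $(x,y)$ has type $bb'$ where $b=1$ iff $\mu(x)=\{\{x,y\}\}$ and $b'=1$ iff $\mu(y)=\{\{x,y\}\}$. $S_\tau$ is the set of selection functions such that exactly $\tau_{bb'}$ edges have type $bb'$ for all $b,b'$.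
   Formalization: The parameters $\rho_{00},\rho_{01},\rho_{10},\rho_{11}$ are rational numbers in [0,1] rather than real ones, so the edge probabilities of $H_6$ are rational as well. -}

module Defs where

open import Data.Bool using (Bool; true; false; if_then_else_)
import Data.Bool.Properties as BoolP
open import Data.Nat using (ℕ; zero; suc)
import Data.Nat as ℕ
open import Data.Fin using (Fin; zero; suc; inject₁; toℕ; remQuot)
import Data.Fin.Properties as FinP
open import Data.Maybe using (Maybe; nothing; just)
import Data.Maybe.Properties as MaybeP
open import Data.Product using (_×_; _,_; proj₁; proj₂; swap)
open import Data.Sum using (_⊎_; inj₁; inj₂)
import Data.Sum.Properties as SumP
import Data.Product.Properties as ProdP
open import Data.List using (List; []; _∷_; map; filter; length; concatMap; foldr)
open import Data.List.Base using (allFin)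
open import Data.Vec using (Vec; []; _∷_; lookup)
open import Data.Integer using (+_)
open import Data.Rational using (ℚ; 0ℚ; 1ℚ; ½; _+_; _*_; _-_; _/_)
open import Relation.Nullary using (¬_; Dec; does)
open import Relation.Nullary.Decidable using (_→-dec_; ¬?; _⊎-dec_; _×-dec_)
open import Relation.Binary.PropositionalEquality using (_≡_; _≢_)
open import Relation.Binary using (DecidableEquality)

sumℚ : List ℚ → ℚ
sumℚ = foldr _+_ 0ℚ

prodℚ : List ℚ → ℚ
prodℚ = foldr _*_ 1ℚ

powℚ : ℚ → ℕ → ℚ
powℚ q zero    = 1ℚ
powℚ q (suc k) = q * powℚ q k

ℕtoℚ : ℕ → ℚ
ℕtoℚ k = + k / 1

bitℚ : Bool → ℚ
bitℚ b = if b then 1ℚ else 0ℚ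

allVecs : {A : Set} → List A → (n : ℕ) → List (Vec A n)
allVecs xs zero    = [] ∷ []
allVecs xs (suc n) = concatMap (λ x → map (x ∷_) (allVecs xs n)) xs

-- Probabilistic graphs and matching probability
-- A probabilistic graph: vertex type V (decidable equality), edges Fin k,
-- endpoints of each edge, probability of each edge.

Disjoint : {V : Set} → V × V → V × V → Set
Disjoint (a , b) (c , d) = (a ≢ c) × (a ≢ d) × (b ≢ c) × (b ≢ d)

IsMatching : {V : Set} {k : ℕ} → (Fin k → V × V) → Vec Bool k → Set
IsMatching {k = k} ends M =
  (e e' : Fin k) → e ≢ e' → lookup M e ≡ true → lookup M e' ≡ true →
  Disjoint (ends e) (ends e')

isMatching? : {V : Set} → DecidableEquality V → {k : ℕ} →
              (ends : Fin k → V × V) → (M : Vec Bool k) → Dec (IsMatching ends M)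
isMatching? _≟_ ends M =
  FinP.all? λ e → FinP.all? λ e' →
    ¬? (e FinP.≟ e') →-dec ((lookup M e BoolP.≟ true) →-dec ((lookup M e' BoolP.≟ true) →-dec
      dis (ends e) (ends e')))
  where
  dis : ∀ p q → Dec (Disjoint p q)
  dis (a , b) (c , d) = ¬? (a ≟ c) ×-dec ¬? (a ≟ d) ×-dec ¬? (b ≟ c) ×-dec ¬? (b ≟ d)

weight : {k : ℕ} → (Fin k → ℚ) → Vec Bool k → ℚ
weight {k} π M = prodℚ (map (λ e → if lookup M e then π e else 1ℚ - π e) (allFin k))

PrMatching : {V : Set} → DecidableEquality V → (k : ℕ) →
             (Fin k → V × V) → (Fin k → ℚ) → ℚ
PrMatching dec k ends π =
  sumℚ (map (weight π) (filter (isMatching? dec ends) (allVecs (true ∷ false ∷ []) k)))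

Π : (n : ℕ) → Vec ℚ n → ℚ
Π n ρ = PrMatching FinP._≟_ n (λ j → inject₁ j , suc j) (lookup ρ)

-- Π^{bb'}_4(ρ) = Π_6(b, ρ00, ρ01, ρ10, ρ11, b');  ρ given as ρ b b' = ρ_{bb'}
Λ : (Bool → Bool → ℚ) → Bool → Bool → ℚ
Λ ρ b b' = Π 6 (bitℚ b ∷ ρ false false ∷ ρ false true ∷ ρ true false ∷ ρ true true ∷ bitℚ b' ∷ [])

-- Oriented graph H: vertices Fin n, edges Fin m, directed edge i = (E i)

Simple : {n m : ℕ} → (Fin m → Fin n × Fin n) → Set
Simple {n} {m} E =
  ((i : Fin m) → proj₁ (E i) ≢ proj₂ (E i)) ×
  ((i j : Fin m) → i ≢ j → (E i ≢ E j) × (E i ≢ swap (E j)))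

-- sub(H,6): vertices of H plus 5 fresh vertices per edge
V6 : ℕ → ℕ → Set
V6 n m = Fin n ⊎ (Fin m × Fin 5)

V6-dec : {n m : ℕ} → DecidableEquality (V6 n m)
V6-dec = SumP.≡-dec FinP._≟_ (ProdP.≡-dec FinP._≟_ FinP._≟_)

pathVertex : {n m : ℕ} → (Fin m → Fin n × Fin n) → Fin m → Fin 7 → V6 n m
pathVertex E i zero = inj₁ (proj₁ (E i))
pathVertex E i (suc zero) = inj₂ (i , zero)
pathVertex E i (suc (suc zero)) = inj₂ (i , suc zero)
pathVertex E i (suc (suc (suc zero))) = inj₂ (i , suc (suc zero))
pathVertex E i (suc (suc (suc (suc zero)))) = inj₂ (i , suc (suc (suc zero)))
pathVertex E i (suc (suc (suc (suc (suc zero))))) = inj₂ (i , suc (suc (suc (suc zero))))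
pathVertex E i (suc (suc (suc (suc (suc (suc zero)))))) = inj₁ (proj₂ (E i))

-- edge (i , j) of sub(H,6), encoded as an element of Fin (m * 6) via remQuot
ends6 : {n m : ℕ} → (Fin m → Fin n × Fin n) → Fin (m ℕ.* 6) → V6 n m × V6 n m
ends6 {m = m} E e with remQuot {m} 6 e
... | i , j = pathVertex E i (inject₁ j) , pathVertex E i (suc j)

π6 : {m : ℕ} → (Bool → Bool → ℚ) → Fin (m ℕ.* 6) → ℚ
π6 {m} ρ e = lookup (½ ∷ ρ false false ∷ ρ false true ∷ ρ true false ∷ ρ true true ∷ ½ ∷ [])
                (proj₂ (remQuot {m} 6 e))

Selection : ℕ → ℕ → Set
Selection n m = Vec (Maybe (Fin m)) n

ValidSelection : {n m : ℕ} → (Fin m → Fin n × Fin n) → Selection n m → Set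
ValidSelection {n} {m} E μ =
  (x : Fin n) (i : Fin m) → lookup μ x ≡ just i → (proj₁ (E i) ≡ x ⊎ proj₂ (E i) ≡ x)

validSelection? : {n m : ℕ} → (E : Fin m → Fin n × Fin n) → (μ : Selection n m) →
                  Dec (ValidSelection E μ)
validSelection? E μ = FinP.all? λ x → FinP.all? λ i →
  MaybeP.≡-dec FinP._≟_ (lookup μ x) (just i) →-dec
    ((proj₁ (E i) FinP.≟ x) ⊎-dec (proj₂ (E i) FinP.≟ x))

selects : {n m : ℕ} → Selection n m → Fin n → Fin m → Bool
selects μ x i = does (MaybeP.≡-dec FinP._≟_ (lookup μ x) (just i))

typeCount : {n m : ℕ} → (Fin m → Fin n × Fin n) → Selection n m → Bool → Bool → ℕ
typeCount {m = m} E μ b b' =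
  length (filter (λ i → (selects μ (proj₁ (E i)) i BoolP.≟ b) ×-dec
                         (selects μ (proj₂ (E i)) i BoolP.≟ b'))
                 (allFin m))

S : {n m : ℕ} → (Fin m → Fin n × Fin n) → (Bool → Bool → Fin (suc m)) → List (Selection n m)
S {n} {m} E τ =
  filter (λ μ → validSelection? E μ ×-dec
                (typeCount E μ false false ℕ.≟ toℕ (τ false false)) ×-dec
                (typeCount E μ false true  ℕ.≟ toℕ (τ false true)) ×-dec
                (typeCount E μ true  false ℕ.≟ toℕ (τ true false)) ×-dec
                (typeCount E μ true  true  ℕ.≟ toℕ (τ true true)))
         (allVecs (nothing ∷ map just (allFin m)) n)

mkτ : {A : Set} → A → A → A → A → Bool → Bool → A
mkτ a00 a01 a10 a11 false false = a00
mkτ a00 a01 a10 a11 false true  = a01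
mkτ a00 a01 a10 a11 true  false = a10
mkτ a00 a01 a10 a11 true  true  = a11

rhsTerm : {n m : ℕ} → (Fin m → Fin n × Fin n) → (Bool → Bool → ℚ) →
          (Bool → Bool → Fin (suc m)) → ℚ
rhsTerm E ρ τ =
  ℕtoℚ (length (S E τ)) *
  (powℚ (Λ ρ false false) (toℕ (τ false false)) *
  (powℚ (Λ ρ false true)  (toℕ (τ false true)) *
  (powℚ (Λ ρ true false)  (toℕ (τ true false)) *
   powℚ (Λ ρ true true)   (toℕ (τ true true)))))

allτ : (m : ℕ) → List (Bool → Bool → Fin (suc m))
allτ m = concatMap (λ a → concatMap (λ b → concatMap (λ c → map (λ d → mkτ a b c d)
           (allFin (suc m))) (allFin (suc m))) (allFin (suc m))) (allFin (suc m))

-- A matching M of sub(H,6) restricts to a matching on each path, and at every vertex x of H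
-- at most one of the end edges at x is present. Recording that edge gives a valid selection
-- function μ, and conversely M is a matching exactly when it extends such a μ: this makes the
-- matching probability a sum over valid μ. For fixed μ the sum over M factorises over the edges
-- of H, and the path of an edge of type bb' contributes ¼ Λ_bb', because its two end edges have
-- probability ½ and μ fixes their presence to b and b'. The factor 2^{2m} cancels the quarters,
-- and grouping the selection functions by their type counts τ gives the right-hand side.

module Submission where

open import Defs
open import Data.Bool using (Bool; true; false; if_then_else_; _∧_)
import Data.Bool.Properties as BoolP
open import Data.Nat using (ℕ; zero; suc; s≤s)
import Data.Nat as ℕ
import Data.Nat.Properties as ℕP
import Data.Nat.Coprimality as Coprime
open import Data.Fin using (Fin; zero; suc; inject₁; toℕ; remQuot; combine)
import Data.Fin.Properties as FinP
open import Data.Maybe using (Maybe; nothing; just)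
import Data.Maybe.Properties as MaybeP
import Data.Product.Properties as ProdP
open import Data.Product using (_×_; _,_; proj₁; proj₂; Σ-syntax)
open import Data.Sum using (_⊎_; inj₁; inj₂)
open import Data.List using (List; []; _∷_; map; filter; length; concatMap; _++_; tabulate)
open import Data.List.Base using (allFin)
import Data.List.Properties as ListP
open import Data.Vec using (Vec; []; _∷_; lookup)
import Data.Vec as Vec
import Data.Vec.Properties as VecP
import Data.Integer as ℤ
import Data.Integer.Properties as ℤP
open import Data.Rational using (ℚ; 0ℚ; 1ℚ; ½; _+_; _*_; _-_; _≤_)
open import Data.Rational.Properties
open import Data.Rational.Solver using (module +-*-Solver)
open import Relation.Nullary using (¬_; Dec; does; yes; no)
open import Relation.Nullary.Decidable using (_×-dec_; _→-dec_; dec-true; dec-false; does-⇔)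
open import Relation.Binary using (DecidableEquality)
open import Data.Empty using (⊥; ⊥-elim)
open import Relation.Binary.PropositionalEquality
open import Function using (_∘_; id; _⇔_; mk⇔; Equivalence)
open import Algebra.Bundles using (CommutativeMonoid)
open import Algebra.Properties.CommutativeSemigroup (CommutativeMonoid.commutativeSemigroup +-0-commutativeMonoid)
  using (interchange)

infixr 8 [_]×_

[_]×_ : Bool → ℚ → ℚ
[ true  ]× q = q
[ false ]× q = 0ℚ

∑ : {A : Set} → List A → (A → ℚ) → ℚ
∑ xs f = sumℚ (map f xs)

module _ {A : Set} where

  ∑-cong : (xs : List A) {f g : A → ℚ} → (∀ x → f x ≡ g x) → ∑ xs f ≡ ∑ xs g
  ∑-cong []       f≗g = refl
  ∑-cong (x ∷ xs) f≗g = cong₂ _+_ (f≗g x) (∑-cong xs f≗g)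

  ∑-++ : (xs ys : List A) (f : A → ℚ) → ∑ (xs ++ ys) f ≡ ∑ xs f + ∑ ys f
  ∑-++ []       ys f = sym (+-identityˡ _)
  ∑-++ (x ∷ xs) ys f = trans (cong (f x +_) (∑-++ xs ys f)) (sym (+-assoc (f x) _ _))

  ∑-zero : (xs : List A) → ∑ xs (λ _ → 0ℚ) ≡ 0ℚ
  ∑-zero []       = refl
  ∑-zero (x ∷ xs) = cong (0ℚ +_) (∑-zero xs)

  ∑-*ˡ : (xs : List A) (c : ℚ) (f : A → ℚ) → c * ∑ xs f ≡ ∑ xs (λ x → c * f x)
  ∑-*ˡ []       c f = *-zeroʳ c
  ∑-*ˡ (x ∷ xs) c f = trans (*-distribˡ-+ c (f x) _) (cong (c * f x +_) (∑-*ˡ xs c f))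

  ∑-*ʳ : (xs : List A) (c : ℚ) (f : A → ℚ) → ∑ xs f * c ≡ ∑ xs (λ x → f x * c)
  ∑-*ʳ xs c f = trans (*-comm _ c) (trans (∑-*ˡ xs c f) (∑-cong xs λ x → *-comm c (f x)))

  ∑-+ : (xs : List A) (f g : A → ℚ) → ∑ xs (λ x → f x + g x) ≡ ∑ xs f + ∑ xs g
  ∑-+ []       f g = refl
  ∑-+ (x ∷ xs) f g = trans (cong (f x + g x +_) (∑-+ xs f g)) (interchange (f x) (g x) _ _)

  ∑-filter : (xs : List A) {P : A → Set} (P? : ∀ x → Dec (P x)) (f : A → ℚ) →
             ∑ (filter P? xs) f ≡ ∑ xs (λ x → [ does (P? x) ]× f x)
  ∑-filter []       P? f = refl
  ∑-filter (x ∷ xs) P? f with does (P? x)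
  ... | true  = cong (f x +_) (∑-filter xs P? f)
  ... | false = trans (∑-filter xs P? f) (sym (+-identityˡ _))

  ∑-guard : (xs : List A) (b : Bool) (f : A → ℚ) → ∑ xs (λ x → [ b ]× f x) ≡ [ b ]× ∑ xs f
  ∑-guard xs true  f = refl
  ∑-guard xs false f = ∑-zero xs

module _ {A B : Set} where

  ∑-map : (xs : List A) (h : A → B) (f : B → ℚ) → ∑ (map h xs) f ≡ ∑ xs (f ∘ h)
  ∑-map []       h f = refl
  ∑-map (x ∷ xs) h f = cong (f (h x) +_) (∑-map xs h f)

  ∑-concatMap : (xs : List A) (g : A → List B) (f : B → ℚ) →
                ∑ (concatMap g xs) f ≡ ∑ xs (λ x → ∑ (g x) f)
  ∑-concatMap []       g f = refl
  ∑-concatMap (x ∷ xs) g f = trans (∑-++ (g x) _ f) (cong (∑ (g x) f +_) (∑-concatMap xs g f))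

  ∑-comm : (xs : List A) (ys : List B) (f : A → B → ℚ) →
           ∑ xs (λ x → ∑ ys (f x)) ≡ ∑ ys (λ y → ∑ xs (λ x → f x y))
  ∑-comm []       ys f = sym (∑-zero ys)
  ∑-comm (x ∷ xs) ys f =
    trans (cong (∑ ys (f x) +_) (∑-comm xs ys f)) (sym (∑-+ ys (f x) λ y → ∑ xs λ x' → f x' y))

  ∑-*-∑ : (xs : List A) (ys : List B) (f : A → ℚ) (g : B → ℚ) →
          ∑ xs (λ x → ∑ ys (λ y → f x * g y)) ≡ ∑ xs f * ∑ ys g
  ∑-*-∑ xs ys f g = trans (∑-cong xs λ x → sym (∑-*ˡ ys (f x) g)) (sym (∑-*ʳ xs (∑ ys g) f))

∑-allFin-suc : ∀ k (f : Fin (suc k) → ℚ) → ∑ (allFin (suc k)) f ≡ f zero + ∑ (allFin k) (f ∘ suc)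
∑-allFin-suc k f =
  cong (f zero +_) (cong sumℚ (trans (ListP.map-tabulate suc f) (sym (ListP.map-tabulate id (f ∘ suc)))))

guard-∧ : ∀ a b q → [ a ∧ b ]× q ≡ [ a ]× [ b ]× q
guard-∧ true  b q = refl
guard-∧ false b q = refl

guard-*ˡ : ∀ b c q → c * [ b ]× q ≡ [ b ]× (c * q)
guard-*ˡ true  c q = refl
guard-*ˡ false c q = *-zeroʳ c

guard-*-guard : ∀ a b p q → [ a ]× p * [ b ]× q ≡ [ a ∧ b ]× (p * q)
guard-*-guard true  true  p q = refl
guard-*-guard true  false p q = *-zeroʳ p
guard-*-guard false b     p q = *-zeroˡ ([ b ]× q)

guard-1ℚ-* : ∀ b q → [ b ]× 1ℚ * q ≡ [ b ]× q
guard-1ℚ-* true  q = *-identityˡ q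
guard-1ℚ-* false q = *-zeroˡ q

from-does : {P : Set} (d : Dec P) → does d ≡ true → P
from-does (yes p) _ = p

≡-does : ∀ b {P : Set} (d : Dec P) → (b ≡ true → P) → (P → b ≡ true) → b ≡ does d
≡-does b     (yes p)  _  from = from p
≡-does false (no ¬p)  _  _    = refl
≡-does true  (no ¬p)  to _    = ⊥-elim (¬p (to refl))

false≢true : false ≢ true
false≢true ()

-- + k / 1 is already normalised, so both sides compute to fractions with denominator 1.
ℕtoℚ-suc : ∀ k → ℕtoℚ (suc k) ≡ 1ℚ + ℕtoℚ k
ℕtoℚ-suc k rewrite normalize-coprime (Coprime.sym (Coprime.1-coprimeTo k)) =
  /-cong {q₁ = 1} {q₂ = 1} (cong (λ z → ℤ.+ 1 ℤ.+ z) (sym (ℤP.*-identityʳ (ℤ.+ k)))) refl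

ℕtoℚ-length-filter : {A : Set} (xs : List A) {P : A → Set} (P? : ∀ x → Dec (P x)) →
                     ℕtoℚ (length (filter P? xs)) ≡ ∑ xs (λ x → [ does (P? x) ]× 1ℚ)
ℕtoℚ-length-filter []       P? = refl
ℕtoℚ-length-filter (x ∷ xs) P? with does (P? x)
... | true  = trans (ℕtoℚ-suc (length (filter P? xs))) (cong (1ℚ +_) (ℕtoℚ-length-filter xs P?))
... | false = trans (ℕtoℚ-length-filter xs P?) (sym (+-identityˡ _))

∑-allVecs-suc : {A : Set} (xs : List A) (k : ℕ) (f : Vec A (suc k) → ℚ) →
                ∑ (allVecs xs (suc k)) f ≡ ∑ xs (λ x → ∑ (allVecs xs k) (λ v → f (x ∷ v)))
∑-allVecs-suc xs k f = trans (∑-concatMap xs _ f) (∑-cong xs λ x → ∑-map (allVecs xs k) (x ∷_) f)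

∑-allVecs-++ : {A : Set} (xs : List A) (a b : ℕ) (f : Vec A (a ℕ.+ b) → ℚ) →
               ∑ (allVecs xs (a ℕ.+ b)) f ≡ ∑ (allVecs xs a) (λ u → ∑ (allVecs xs b) (λ w → f (u Vec.++ w)))
∑-allVecs-++ xs zero    b f = sym (+-identityʳ _)
∑-allVecs-++ xs (suc a) b f = begin
  ∑ (allVecs xs (suc a ℕ.+ b)) f
    ≡⟨ ∑-allVecs-suc xs (a ℕ.+ b) f ⟩
  ∑ xs (λ x → ∑ (allVecs xs (a ℕ.+ b)) (λ v → f (x ∷ v)))
    ≡⟨ ∑-cong xs (λ x → ∑-allVecs-++ xs a b (f ∘ (x ∷_))) ⟩
  ∑ xs (λ x → ∑ (allVecs xs a) (λ u → ∑ (allVecs xs b) (λ w → f (x ∷ u Vec.++ w))))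
    ≡⟨ ∑-allVecs-suc xs a _ ⟨
  ∑ (allVecs xs (suc a)) (λ u → ∑ (allVecs xs b) (λ w → f (u Vec.++ w))) ∎
  where open ≡-Reasoning

CountsOnce : {A : Set} → DecidableEquality A → List A → Set
CountsOnce _≟_ xs = ∀ a → ∑ xs (λ x → [ does (x ≟ a) ]× 1ℚ) ≡ 1ℚ

allFin-countsOnce : ∀ k → CountsOnce FinP._≟_ (allFin k)
allFin-countsOnce (suc k) zero    =
  trans (∑-allFin-suc k (λ x → [ does (x FinP.≟ zero) ]× 1ℚ))
        (trans (cong (1ℚ +_) (∑-zero (allFin k))) (+-identityʳ 1ℚ))
allFin-countsOnce (suc k) (suc j) =
  trans (∑-allFin-suc k (λ x → [ does (x FinP.≟ suc j) ]× 1ℚ)) (trans (+-identityˡ _) (allFin-countsOnce k j))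

maybeFin-countsOnce : ∀ k → CountsOnce (MaybeP.≡-dec FinP._≟_) (nothing ∷ map just (allFin k))
maybeFin-countsOnce k nothing  =
  trans (cong (1ℚ +_) (trans (∑-map (allFin k) just _) (∑-zero (allFin k)))) (+-identityʳ 1ℚ)
maybeFin-countsOnce k (just j) =
  trans (+-identityˡ _) (trans (∑-map (allFin k) just _) (allFin-countsOnce k j))

allVecs-countsOnce : {A : Set} {_≟_ : DecidableEquality A} {xs : List A} → CountsOnce _≟_ xs →
                     ∀ k → CountsOnce (VecP.≡-dec _≟_) (allVecs xs k)
allVecs-countsOnce         once zero    []      = refl
allVecs-countsOnce {_≟_ = _≟_} {xs} once (suc k) (a ∷ w) = begin
  ∑ (allVecs xs (suc k)) (λ v → [ does (VecP.≡-dec _≟_ v (a ∷ w)) ]× 1ℚ)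
    ≡⟨ ∑-allVecs-suc xs k _ ⟩
  ∑ xs (λ x → ∑ (allVecs xs k) (λ v → [ does (x ≟ a) ∧ does (VecP.≡-dec _≟_ v w) ]× 1ℚ))
    ≡⟨ ∑-cong xs (λ x → trans (∑-cong (allVecs xs k) λ v → guard-∧ (does (x ≟ a)) _ 1ℚ)
                              (∑-guard (allVecs xs k) (does (x ≟ a)) _)) ⟩
  ∑ xs (λ x → [ does (x ≟ a) ]× ∑ (allVecs xs k) (λ v → [ does (VecP.≡-dec _≟_ v w) ]× 1ℚ))
    ≡⟨ ∑-cong xs (λ x → cong [ does (x ≟ a) ]×_ (allVecs-countsOnce once k w)) ⟩
  ∑ xs (λ x → [ does (x ≟ a) ]× 1ℚ)
    ≡⟨ once a ⟩
  1ℚ ∎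
  where open ≡-Reasoning

∑-allFin-pick : ∀ m k → k ℕ.< suc m → (Φ : Bool → ℕ → ℚ) → (∀ n → Φ false n ≡ 0ℚ) →
                ∑ (allFin (suc m)) (λ a → Φ (does (k ℕ.≟ toℕ a)) (toℕ a)) ≡ Φ true k
∑-allFin-pick m       zero    _         Φ Φ-false =
  trans (∑-allFin-suc m (λ a → Φ (does (0 ℕ.≟ toℕ a)) (toℕ a)))
        (trans (cong (Φ true 0 +_) (trans (∑-cong (allFin m) (Φ-false ∘ suc ∘ toℕ)) (∑-zero (allFin m))))
               (+-identityʳ (Φ true 0)))
∑-allFin-pick (suc m) (suc k) (s≤s k<m) Φ Φ-false =
  trans (∑-allFin-suc (suc m) (λ a → Φ (does (suc k ℕ.≟ toℕ a)) (toℕ a)))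
        (trans (cong (_+ rest) (Φ-false 0))
               (trans (+-identityˡ rest) (∑-allFin-pick m k k<m (λ b n → Φ b (suc n)) (Φ-false ∘ suc))))
  where rest = ∑ (allFin (suc m)) (λ a → Φ (does (k ℕ.≟ toℕ a)) (suc (toℕ a)))

∏ : (m : ℕ) → (Fin m → ℚ) → ℚ
∏ zero    f = 1ℚ
∏ (suc m) f = f zero * ∏ m (f ∘ suc)

∏-cong : ∀ m {f g : Fin m → ℚ} → (∀ i → f i ≡ g i) → ∏ m f ≡ ∏ m g
∏-cong zero    f≗g = refl
∏-cong (suc m) f≗g = cong₂ _*_ (f≗g zero) (∏-cong m (f≗g ∘ suc))

prodℚ-++ : (xs ys : List ℚ) → prodℚ (xs ++ ys) ≡ prodℚ xs * prodℚ ys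
prodℚ-++ []       ys = sym (*-identityˡ _)
prodℚ-++ (x ∷ xs) ys = trans (cong (x *_) (prodℚ-++ xs ys)) (sym (*-assoc x _ _))

∏≡prodℚ : ∀ m (f : Fin m → ℚ) → ∏ m f ≡ prodℚ (map f (allFin m))
∏≡prodℚ zero    f = refl
∏≡prodℚ (suc m) f = cong (f zero *_)
  (trans (∏≡prodℚ m (f ∘ suc)) (cong prodℚ (trans (ListP.map-tabulate id (f ∘ suc)) (sym (ListP.map-tabulate suc f)))))

⋀ : (m : ℕ) → (Fin m → Bool) → Bool
⋀ zero    p = true
⋀ (suc m) p = p zero ∧ ⋀ m (p ∘ suc)

⋀-true⁻ : ∀ m (p : Fin m → Bool) → ⋀ m p ≡ true → ∀ i → p i ≡ true
⋀-true⁻ (suc m) p all zero    = BoolP.∧-conicalˡ _ _ all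
⋀-true⁻ (suc m) p all (suc i) = ⋀-true⁻ m (p ∘ suc) (BoolP.∧-conicalʳ (p zero) _ all) i

⋀-true⁺ : ∀ m (p : Fin m → Bool) → (∀ i → p i ≡ true) → ⋀ m p ≡ true
⋀-true⁺ zero    p all = refl
⋀-true⁺ (suc m) p all rewrite all zero = ⋀-true⁺ m (p ∘ suc) (all ∘ suc)

guard-⋀ : ∀ m (p : Fin m → Bool) (g : Fin m → ℚ) → [ ⋀ m p ]× ∏ m g ≡ ∏ m (λ i → [ p i ]× g i)
guard-⋀ zero    p g = refl
guard-⋀ (suc m) p g = begin
  [ p zero ∧ ⋀ m (p ∘ suc) ]× (g zero * ∏ m (g ∘ suc))   ≡⟨ guard-*-guard (p zero) (⋀ m (p ∘ suc)) _ _ ⟨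
  [ p zero ]× g zero * [ ⋀ m (p ∘ suc) ]× ∏ m (g ∘ suc) ≡⟨ cong ([ p zero ]× g zero *_) (guard-⋀ m (p ∘ suc) (g ∘ suc)) ⟩
  [ p zero ]× g zero * ∏ m (λ i → [ p (suc i) ]× g (suc i)) ∎
  where open ≡-Reasoning


-- Matchings of a path

suc≢inject₁ : ∀ {k} (a : Fin k) → suc a ≢ inject₁ a
suc≢inject₁ zero    ()
suc≢inject₁ (suc a) eq = suc≢inject₁ a (FinP.suc-injective eq)

pathEdges : ∀ k → Fin k → Fin (suc k) × Fin (suc k)
pathEdges k j = inject₁ j , suc j

AdjacentFree : ∀ {k} → Vec Bool k → Set
AdjacentFree {k} u = ∀ (a b : Fin k) → suc a ≡ inject₁ b → lookup u a ≡ true → lookup u b ≡ true → ⊥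

adjacentFree? : ∀ {k} (u : Vec Bool k) → Dec (AdjacentFree u)
adjacentFree? u = FinP.all? λ a → FinP.all? λ b →
  (suc a FinP.≟ inject₁ b) →-dec ((lookup u a BoolP.≟ true) →-dec ((lookup u b BoolP.≟ true) →-dec no id))

isMatching-path⇔adjacentFree : ∀ {k} (u : Vec Bool k) → IsMatching (pathEdges k) u ⇔ AdjacentFree u
isMatching-path⇔adjacentFree u = mk⇔ matching⇒adjacentFree adjacentFree⇒matching
  where
  matching⇒adjacentFree : IsMatching (pathEdges _) u → AdjacentFree u
  matching⇒adjacentFree isM a b a~b ua ub =
    proj₁ (proj₂ (proj₂ (isM a b (λ { refl → suc≢inject₁ a a~b }) ua ub))) a~b
  adjacentFree⇒matching : AdjacentFree u → IsMatching (pathEdges _) u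
  adjacentFree⇒matching free e e' e≢e' ue ue' =
    (e≢e' ∘ FinP.inject₁-injective) ,
    (λ e'~e → free e' e (sym e'~e) ue' ue) ,
    (λ e~e' → free e e' e~e' ue ue') ,
    (e≢e' ∘ FinP.suc-injective)

Disjoint-preimage : {A B : Set} (f : A → B) {a b c d : A} → Disjoint (f a , f b) (f c , f d) → Disjoint (a , b) (c , d)
Disjoint-preimage f (a≢c , a≢d , b≢c , b≢d) = a≢c ∘ cong f , a≢d ∘ cong f , b≢c ∘ cong f , b≢d ∘ cong f


-- The path replacing one edge of H

bools : List Bool
bools = true ∷ false ∷ []

_≟²_ : DecidableEquality (Bool × Bool)
_≟²_ = ProdP.≡-dec BoolP._≟_ BoolP._≟_

endBits : Vec Bool 6 → Bool × Bool
endBits (a ∷ _ ∷ _ ∷ _ ∷ _ ∷ f ∷ []) = a , f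

admissible : Bool × Bool → Vec Bool 6 → Bool
admissible t u = does (adjacentFree? u) ∧ does (endBits u ≟² t)

gadgetProbs : (Bool → Bool → ℚ) → Fin 6 → ℚ
gadgetProbs ρ = lookup (½ ∷ ρ false false ∷ ρ false true ∷ ρ true false ∷ ρ true true ∷ ½ ∷ [])

ΛProbs : (Bool → Bool → ℚ) → Bool → Bool → Fin 6 → ℚ
ΛProbs ρ β β' = lookup (bitℚ β ∷ ρ false false ∷ ρ false true ∷ ρ true false ∷ ρ true true ∷ bitℚ β' ∷ [])

module _ (ρ : Bool → Bool → ℚ) where

  private
    factor : ℚ → Bool → ℚ
    factor p x = if x then p else 1ℚ - p

    open +-*-Solver

    ends-agree : ∀ B C D E → ½ * (B * (C * (D * (E * (½ * 1ℚ))))) ≡ ½ * (½ * (1ℚ * (B * (C * (D * (E * (1ℚ * 1ℚ)))))))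
    ends-agree = solve 4 (λ B C D E → con ½ :* (B :* (C :* (D :* (E :* (con ½ :* con 1ℚ))))) :=
                                       con ½ :* (con ½ :* (con 1ℚ :* (B :* (C :* (D :* (E :* (con 1ℚ :* con 1ℚ)))))))) refl

    first-disagrees : ∀ B C D E w → 0ℚ ≡ ½ * (½ * (0ℚ * (B * (C * (D * (E * (w * 1ℚ)))))))
    first-disagrees = solve 5 (λ B C D E w → con 0ℚ := con ½ :* (con ½ :* (con 0ℚ :* (B :* (C :* (D :* (E :* (w :* con 1ℚ)))))))) refl

    last-disagrees : ∀ B C D E → 0ℚ ≡ ½ * (½ * (1ℚ * (B * (C * (D * (E * (0ℚ * 1ℚ)))))))
    last-disagrees = solve 4 (λ B C D E → con 0ℚ := con ½ :* (con ½ :* (con 1ℚ :* (B :* (C :* (D :* (E :* (con 0ℚ :* con 1ℚ)))))))) refl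

  -- The end edges of a gadget carry probability ½; fixing their presence to the bits β, β'
  -- instead turns the gadget's weight into the weight of the Π^{ββ'}_4 path, up to ¼.
  gadget-weight : ∀ β β' u →
    [ does (endBits u ≟² (β , β')) ]× weight (gadgetProbs ρ) u ≡ ½ * (½ * weight (ΛProbs ρ β β') u)
  gadget-weight true  true  (true  ∷ b ∷ c ∷ d ∷ e ∷ true  ∷ []) = ends-agree (factor _ b) (factor _ c) (factor _ d) (factor _ e)
  gadget-weight true  false (true  ∷ b ∷ c ∷ d ∷ e ∷ false ∷ []) = ends-agree (factor _ b) (factor _ c) (factor _ d) (factor _ e)
  gadget-weight false true  (false ∷ b ∷ c ∷ d ∷ e ∷ true  ∷ []) = ends-agree (factor _ b) (factor _ c) (factor _ d) (factor _ e)
  gadget-weight false false (false ∷ b ∷ c ∷ d ∷ e ∷ false ∷ []) = ends-agree (factor _ b) (factor _ c) (factor _ d) (factor _ e)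
  gadget-weight true  true  (true  ∷ b ∷ c ∷ d ∷ e ∷ false ∷ []) = last-disagrees (factor _ b) (factor _ c) (factor _ d) (factor _ e)
  gadget-weight true  false (true  ∷ b ∷ c ∷ d ∷ e ∷ true  ∷ []) = last-disagrees (factor _ b) (factor _ c) (factor _ d) (factor _ e)
  gadget-weight false true  (false ∷ b ∷ c ∷ d ∷ e ∷ false ∷ []) = last-disagrees (factor _ b) (factor _ c) (factor _ d) (factor _ e)
  gadget-weight false false (false ∷ b ∷ c ∷ d ∷ e ∷ true  ∷ []) = last-disagrees (factor _ b) (factor _ c) (factor _ d) (factor _ e)
  gadget-weight true  β'    (false ∷ b ∷ c ∷ d ∷ e ∷ f ∷ []) =
    first-disagrees (factor _ b) (factor _ c) (factor _ d) (factor _ e) (factor (bitℚ β') f)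
  gadget-weight false β'    (true  ∷ b ∷ c ∷ d ∷ e ∷ f ∷ []) =
    first-disagrees (factor _ b) (factor _ c) (factor _ d) (factor _ e) (factor (bitℚ β') f)

  ∑-admissible-gadgets : ∀ β β' →
    ∑ (allVecs bools 6) (λ u → [ admissible (β , β') u ]× weight (gadgetProbs ρ) u) ≡ ½ * (½ * Λ ρ β β')
  ∑-admissible-gadgets β β' = begin
    ∑ us (λ u → [ admissible (β , β') u ]× weight (gadgetProbs ρ) u)
      ≡⟨ ∑-cong us pointwise ⟩
    ∑ us (λ u → ½ * (½ * [ matching? u ]× weight π u))
      ≡⟨ trans (cong (½ *_) (∑-*ˡ us ½ guarded)) (∑-*ˡ us ½ (λ u → ½ * guarded u)) ⟨
    ½ * (½ * ∑ us (λ u → [ matching? u ]× weight π u))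
      ≡⟨ cong (λ s → ½ * (½ * s)) (∑-filter us (isMatching? FinP._≟_ (pathEdges 6)) (weight π)) ⟨
    ½ * (½ * Λ ρ β β') ∎
    where
    open ≡-Reasoning
    us = allVecs bools 6
    π = ΛProbs ρ β β'
    matching? : Vec Bool 6 → Bool
    matching? u = does (isMatching? FinP._≟_ (pathEdges 6) u)
    guarded : Vec Bool 6 → ℚ
    guarded u = [ matching? u ]× weight π u
    pointwise : ∀ u → [ admissible (β , β') u ]× weight (gadgetProbs ρ) u ≡ ½ * (½ * [ matching? u ]× weight π u)
    pointwise u = begin
      [ admissible (β , β') u ]× weight (gadgetProbs ρ) u
        ≡⟨ guard-∧ (does (adjacentFree? u)) _ _ ⟩
      [ does (adjacentFree? u) ]× [ does (endBits u ≟² (β , β')) ]× weight (gadgetProbs ρ) u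
        ≡⟨ cong [ does (adjacentFree? u) ]×_ (gadget-weight β β' u) ⟩
      [ does (adjacentFree? u) ]× (½ * (½ * weight π u))
        ≡⟨ trans (cong (½ *_) (guard-*ˡ free ½ (weight π u))) (guard-*ˡ free ½ (½ * weight π u)) ⟨
      ½ * (½ * [ does (adjacentFree? u) ]× weight π u)
        ≡⟨ cong (λ b → ½ * (½ * [ b ]× weight π u))
                (does-⇔ (isMatching-path⇔adjacentFree u) (isMatching? FinP._≟_ (pathEdges 6) u) (adjacentFree? u)) ⟨
      ½ * (½ * [ matching? u ]× weight π u) ∎
      where free = does (adjacentFree? u)


-- An edge set of sub(H,6) is a vector indexed by combine i j (H-edge i, position j on its
-- path), so it splits into m consecutive blocks of 6 entries, one per path.
block : {A : Set} {m : ℕ} → Vec A (m ℕ.* 6) → Fin m → Vec A 6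
block (a ∷ b ∷ c ∷ d ∷ e ∷ f ∷ _) zero    = a ∷ b ∷ c ∷ d ∷ e ∷ f ∷ []
block (_ ∷ _ ∷ _ ∷ _ ∷ _ ∷ _ ∷ r) (suc i) = block r i

lookup-block : {A : Set} {m : ℕ} (M : Vec A (m ℕ.* 6)) (i : Fin m) (j : Fin 6) →
               lookup (block M i) j ≡ lookup M (combine i j)
lookup-block (a ∷ b ∷ c ∷ d ∷ e ∷ f ∷ r) zero    zero                                = refl
lookup-block (a ∷ b ∷ c ∷ d ∷ e ∷ f ∷ r) zero    (suc zero)                          = refl
lookup-block (a ∷ b ∷ c ∷ d ∷ e ∷ f ∷ r) zero    (suc (suc zero))                    = refl
lookup-block (a ∷ b ∷ c ∷ d ∷ e ∷ f ∷ r) zero    (suc (suc (suc zero)))              = refl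
lookup-block (a ∷ b ∷ c ∷ d ∷ e ∷ f ∷ r) zero    (suc (suc (suc (suc zero))))        = refl
lookup-block (a ∷ b ∷ c ∷ d ∷ e ∷ f ∷ r) zero    (suc (suc (suc (suc (suc zero))))) = refl
lookup-block (_ ∷ _ ∷ _ ∷ _ ∷ _ ∷ _ ∷ r) (suc i) j                                   = lookup-block r i j

∑-∏-block : {A : Set} (xs : List A) (m : ℕ) (g : Fin m → Vec A 6 → ℚ) →
            ∑ (allVecs xs (m ℕ.* 6)) (λ M → ∏ m (λ i → g i (block M i))) ≡ ∏ m (λ i → ∑ (allVecs xs 6) (g i))
∑-∏-block xs zero    g = +-identityʳ 1ℚ
∑-∏-block xs (suc m) g = begin
  ∑ (allVecs xs (6 ℕ.+ m ℕ.* 6)) (λ M → ∏ (suc m) (λ i → g i (block M i)))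
    ≡⟨ ∑-allVecs-++ xs 6 (m ℕ.* 6) _ ⟩
  ∑ (allVecs xs 6) (λ u → ∑ (allVecs xs (m ℕ.* 6)) (λ M → ∏ (suc m) (λ i → g i (block (u Vec.++ M) i))))
    ≡⟨ ∑-cong (allVecs xs 6) (λ { (_ ∷ _ ∷ _ ∷ _ ∷ _ ∷ _ ∷ []) → refl }) ⟩
  ∑ (allVecs xs 6) (λ u → ∑ (allVecs xs (m ℕ.* 6)) (λ M → g zero u * ∏ m (λ i → g (suc i) (block M i))))
    ≡⟨ ∑-*-∑ (allVecs xs 6) (allVecs xs (m ℕ.* 6)) (g zero) _ ⟩
  ∑ (allVecs xs 6) (g zero) * ∑ (allVecs xs (m ℕ.* 6)) (λ M → ∏ m (λ i → g (suc i) (block M i)))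
    ≡⟨ cong (∑ (allVecs xs 6) (g zero) *_) (∑-∏-block xs m (g ∘ suc)) ⟩
  ∑ (allVecs xs 6) (g zero) * ∏ m (λ i → ∑ (allVecs xs 6) (g (suc i))) ∎
  where open ≡-Reasoning

weight-π6 : ∀ (ρ : Bool → Bool → ℚ) m (M : Vec Bool (m ℕ.* 6)) →
            weight (π6 {m} ρ) M ≡ ∏ m (λ i → weight (gadgetProbs ρ) (block M i))
weight-π6 ρ zero    []                          = refl
weight-π6 ρ (suc m) (a ∷ b ∷ c ∷ d ∷ e ∷ f ∷ r) =
  trans (prodℚ-++ (map (factor (gadgetProbs ρ) u) (allFin 6)) (map (factor (π6 {suc m} ρ) (u Vec.++ r)) (tabulate shift)))
        (cong (weight (gadgetProbs ρ) u *_)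
              (trans (cong prodℚ (trans (ListP.map-tabulate shift _) (sym (ListP.map-tabulate id _))))
                     (weight-π6 ρ m r)))
  where
  u = a ∷ b ∷ c ∷ d ∷ e ∷ f ∷ []
  factor : ∀ {k} → (Fin k → ℚ) → Vec Bool k → Fin k → ℚ
  factor π M e = if lookup M e then π e else 1ℚ - π e
  shift : Fin (m ℕ.* 6) → Fin (suc m ℕ.* 6)
  shift e = suc (suc (suc (suc (suc (suc e)))))

compatible : ∀ {m} → (Fin m → Bool × Bool) → Vec Bool (m ℕ.* 6) → Bool
compatible {m} t M = ⋀ m (λ i → admissible (t i) (block M i))

∑-compatible-weights : ∀ (ρ : Bool → Bool → ℚ) m (t : Fin m → Bool × Bool) →
  ∑ (allVecs bools (m ℕ.* 6)) (λ M → [ compatible t M ]× weight (π6 {m} ρ) M)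
    ≡ ∏ m (λ i → ½ * (½ * Λ ρ (proj₁ (t i)) (proj₂ (t i))))
∑-compatible-weights ρ m t = begin
  ∑ (allVecs bools (m ℕ.* 6)) (λ M → [ compatible t M ]× weight (π6 {m} ρ) M)
    ≡⟨ ∑-cong (allVecs bools (m ℕ.* 6)) (λ M → trans (cong ([ compatible t M ]×_) (weight-π6 ρ m M)) (guard-⋀ m _ _)) ⟩
  ∑ (allVecs bools (m ℕ.* 6)) (λ M → ∏ m (λ i → [ admissible (t i) (block M i) ]× weight (gadgetProbs ρ) (block M i)))
    ≡⟨ ∑-∏-block bools m (λ i u → [ admissible (t i) u ]× weight (gadgetProbs ρ) u) ⟩
  ∏ m (λ i → ∑ (allVecs bools 6) (λ u → [ admissible (t i) u ]× weight (gadgetProbs ρ) u))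
    ≡⟨ ∏-cong m (λ i → ∑-admissible-gadgets ρ (proj₁ (t i)) (proj₂ (t i))) ⟩
  ∏ m (λ i → ½ * (½ * Λ ρ (proj₁ (t i)) (proj₂ (t i)))) ∎
  where open ≡-Reasoning

endPosition : Bool → Fin 6
endPosition false = zero
endPosition true  = suc (suc (suc (suc (suc zero))))

endPosition-injective : ∀ {s s'} → endPosition s ≡ endPosition s' → s ≡ s'
endPosition-injective {false} {false} _ = refl
endPosition-injective {true}  {true}  _ = refl

endBits≡lookups : (u : Vec Bool 6) → endBits u ≡ (lookup u (endPosition false) , lookup u (endPosition true))
endBits≡lookups (_ ∷ _ ∷ _ ∷ _ ∷ _ ∷ _ ∷ []) = refl

selections : ∀ n m → List (Selection n m)
selections n m = allVecs (nothing ∷ map just (allFin m)) n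

selections-countsOnce : ∀ n m → CountsOnce (VecP.≡-dec (MaybeP.≡-dec FinP._≟_)) (selections n m)
selections-countsOnce n m = allVecs-countsOnce (maybeFin-countsOnce m) n


-- Matchings of sub(H,6) and selection functions

module SubdividedGraph {n m : ℕ} (E : Fin m → Fin n × Fin n) where

  endpoint : Fin m → Bool → Fin n
  endpoint i false = proj₁ (E i)
  endpoint i true  = proj₂ (E i)

  private
    vertex : Fin m → Fin 7 → V6 n m
    vertex = pathVertex E

  pathEdge : Fin m → Fin 6 → V6 n m × V6 n m
  pathEdge i j = vertex i (inject₁ j) , vertex i (suc j)

  ends6-combine : ∀ i j → ends6 E (combine i j) ≡ pathEdge i j
  ends6-combine i j =
    cong (λ ij → pathEdge (proj₁ ij) (proj₂ ij)) (FinP.remQuot-combine {m} {6} i j)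

  vertex-inner : ∀ i k i' t → vertex i k ≡ inj₂ (i' , t) → i ≡ i' × k ≡ suc (inject₁ t)
  vertex-inner i zero                                      _ _ ()
  vertex-inner i (suc zero)                                _ _ refl = refl , refl
  vertex-inner i (suc (suc zero))                          _ _ refl = refl , refl
  vertex-inner i (suc (suc (suc zero)))                    _ _ refl = refl , refl
  vertex-inner i (suc (suc (suc (suc zero))))              _ _ refl = refl , refl
  vertex-inner i (suc (suc (suc (suc (suc zero)))))        _ _ refl = refl , refl
  vertex-inner i (suc (suc (suc (suc (suc (suc zero)))))) _ _ ()

  first-vertex-outer : ∀ i j x → vertex i (inject₁ j) ≡ inj₁ x → j ≡ endPosition false × endpoint i false ≡ x
  first-vertex-outer i zero                                _ refl = refl , refl
  first-vertex-outer i (suc zero)                          _ ()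
  first-vertex-outer i (suc (suc zero))                    _ ()
  first-vertex-outer i (suc (suc (suc zero)))              _ ()
  first-vertex-outer i (suc (suc (suc (suc zero))))        _ ()
  first-vertex-outer i (suc (suc (suc (suc (suc zero))))) _ ()

  second-vertex-outer : ∀ i j x → vertex i (suc j) ≡ inj₁ x → j ≡ endPosition true × endpoint i true ≡ x
  second-vertex-outer i zero                                _ ()
  second-vertex-outer i (suc zero)                          _ ()
  second-vertex-outer i (suc (suc zero))                    _ ()
  second-vertex-outer i (suc (suc (suc zero)))              _ ()
  second-vertex-outer i (suc (suc (suc (suc zero))))        _ ()
  second-vertex-outer i (suc (suc (suc (suc (suc zero))))) _ refl = refl , refl

  end-edges-meet : ∀ i i' s s' → endpoint i s ≡ endpoint i' s' →
                   ¬ Disjoint (pathEdge i (endPosition s)) (pathEdge i' (endPosition s'))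
  end-edges-meet i i' false false meet (≢ , _ , _ , _) = ≢ (cong inj₁ meet)
  end-edges-meet i i' false true  meet (_ , ≢ , _ , _) = ≢ (cong inj₁ meet)
  end-edges-meet i i' true  false meet (_ , _ , ≢ , _) = ≢ (cong inj₁ meet)
  end-edges-meet i i' true  true  meet (_ , _ , _ , ≢) = ≢ (cong inj₁ meet)

  module _ (M : Vec Bool (m ℕ.* 6)) where

    Present : Fin m → Fin 6 → Set
    Present i j = lookup M (combine i j) ≡ true

    BlocksAdjacentFree : Set
    BlocksAdjacentFree = ∀ (i : Fin m) → AdjacentFree (block M i)

    EndEdgesDisjoint : Set
    EndEdgesDisjoint = ∀ i i' s s' → endpoint i s ≡ endpoint i' s' →
      Present i (endPosition s) → Present i' (endPosition s') → i ≡ i' × s ≡ s'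

    matching⇒disjoint : IsMatching (ends6 E) M → ∀ {i j i' j'} → ¬ (i ≡ i' × j ≡ j') →
                        Present i j → Present i' j' → Disjoint (pathEdge i j) (pathEdge i' j')
    matching⇒disjoint isM {i} {j} {i'} {j'} ij≢i'j' present present' =
      subst₂ Disjoint (ends6-combine i j) (ends6-combine i' j')
        (isM (combine i j) (combine i' j') (ij≢i'j' ∘ FinP.combine-injective i j i' j') present present')

    matching⇒blocksAdjacentFree : IsMatching (ends6 E) M → BlocksAdjacentFree
    matching⇒blocksAdjacentFree isM i =
      Equivalence.to (isMatching-path⇔adjacentFree (block M i)) λ a b a≢b ua ub →
        Disjoint-preimage (vertex i)
          (matching⇒disjoint isM (a≢b ∘ proj₂)
            (trans (sym (lookup-block M i a)) ua) (trans (sym (lookup-block M i b)) ub))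

    matching⇒endEdgesDisjoint : IsMatching (ends6 E) M → EndEdgesDisjoint
    matching⇒endEdgesDisjoint isM i i' s s' meet present present'
      with i FinP.≟ i' | s BoolP.≟ s'
    ... | yes i≡i' | yes s≡s' = i≡i' , s≡s'
    ... | no i≢i'  | _        =
      ⊥-elim (end-edges-meet i i' s s' meet (matching⇒disjoint isM (i≢i' ∘ proj₁) present present'))
    ... | yes _    | no s≢s'  =
      ⊥-elim (end-edges-meet i i' s s' meet
        (matching⇒disjoint isM (s≢s' ∘ endPosition-injective ∘ proj₂) present present'))

    private
      EdgeEnd : Fin 6 → Fin 7 → Set
      EdgeEnd j k = k ≡ inject₁ j ⊎ k ≡ suc j

      outer-end : ∀ i j k x → EdgeEnd j k → vertex i k ≡ inj₁ x →
                  Σ[ s ∈ Bool ] (j ≡ endPosition s × endpoint i s ≡ x)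
      outer-end i j _ x (inj₁ refl) eq = false , first-vertex-outer i j x eq
      outer-end i j _ x (inj₂ refl) eq = true , second-vertex-outer i j x eq

      -- A vertex inside the path of i lies only on edges of that path, where present edges
      -- are not adjacent; a vertex of H lies only on end edges, which are separated.
      no-shared-vertex : BlocksAdjacentFree → EndEdgesDisjoint →
        ∀ {i j i' j'} → ¬ (i ≡ i' × j ≡ j') → Present i j → Present i' j' →
        ∀ {k k'} → EdgeEnd j k → EdgeEnd j' k' → vertex i k ≢ vertex i' k'
      no-shared-vertex free sep {i} {j} {i'} {j'} distinct p p' {k} {k'} end end' same
        with vertex i k in eq
      ... | inj₂ (i'' , t) with vertex-inner i k i'' t eq | vertex-inner i' k' i'' t (sym same)
      ...   | refl , refl | refl , refl with end | end'
      ...     | inj₁ k≡j | inj₁ k≡j' = distinct (refl , FinP.inject₁-injective (trans (sym k≡j) k≡j'))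
      ...     | inj₂ k≡j | inj₂ k≡j' = distinct (refl , FinP.suc-injective (trans (sym k≡j) k≡j'))
      ...     | inj₁ k≡j | inj₂ k≡j' =
        free i j' j (trans (sym k≡j') k≡j) (trans (lookup-block M i j') p') (trans (lookup-block M i j) p)
      ...     | inj₂ k≡j | inj₁ k≡j' =
        free i j j' (trans (sym k≡j) k≡j') (trans (lookup-block M i j) p) (trans (lookup-block M i j') p')
      no-shared-vertex free sep {i} {j} {i'} {j'} distinct p p' {k} {k'} end end' same
        | inj₁ x with outer-end i j k x end eq | outer-end i' j' k' x end' (sym same)
      ... | s , refl , ex | s' , refl , ex' with sep i i' s s' (trans ex (sym ex')) p p'
      ...   | refl , refl = distinct (refl , refl)

    separated⇒matching : BlocksAdjacentFree → EndEdgesDisjoint → IsMatching (ends6 E) M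
    separated⇒matching free sep e e' e≢e' pe pe' =
      shared (inj₁ refl) (inj₁ refl) , shared (inj₁ refl) (inj₂ refl) ,
      shared (inj₂ refl) (inj₁ refl) , shared (inj₂ refl) (inj₂ refl)
      where
      e≡ : ∀ e → combine (proj₁ (remQuot {m} 6 e)) (proj₂ (remQuot {m} 6 e)) ≡ e
      e≡ = FinP.combine-remQuot {m} 6
      shared = no-shared-vertex free sep
        (λ { (i≡ , j≡) → e≢e' (trans (sym (e≡ e)) (trans (cong₂ combine i≡ j≡) (e≡ e'))) })
        (trans (cong (lookup M) (e≡ e)) pe) (trans (cong (lookup M) (e≡ e')) pe')

  sideBits : Selection n m → Fin m → Bool × Bool
  sideBits μ i = selects μ (endpoint i false) i , selects μ (endpoint i true) i

  module _ (μ : Selection n m) (M : Vec Bool (m ℕ.* 6)) where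

    Agrees : Set
    Agrees = ∀ i s → lookup M (combine i (endPosition s)) ≡ selects μ (endpoint i s) i

    compatible⇒ : compatible (sideBits μ) M ≡ true → BlocksAdjacentFree M × Agrees
    compatible⇒ compat = free , agrees
      where
      admissible-i : ∀ i → admissible (sideBits μ i) (block M i) ≡ true
      admissible-i = ⋀-true⁻ m _ compat
      free : BlocksAdjacentFree M
      free i = from-does (adjacentFree? (block M i)) (BoolP.∧-conicalˡ _ _ (admissible-i i))
      ends : ∀ i → (lookup (block M i) (endPosition false) , lookup (block M i) (endPosition true)) ≡ sideBits μ i
      ends i = trans (sym (endBits≡lookups (block M i)))
                     (from-does (endBits (block M i) ≟² sideBits μ i) (BoolP.∧-conicalʳ _ _ (admissible-i i)))
      agrees : Agrees
      agrees i false = trans (sym (lookup-block M i _)) (cong proj₁ (ends i))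
      agrees i true  = trans (sym (lookup-block M i _)) (cong proj₂ (ends i))

    compatible⇐ : BlocksAdjacentFree M → Agrees → compatible (sideBits μ) M ≡ true
    compatible⇐ free agrees = ⋀-true⁺ m _ λ i →
      cong₂ _∧_ (dec-true (adjacentFree? (block M i)) (free i))
                (dec-true (endBits (block M i) ≟² sideBits μ i)
                  (trans (endBits≡lookups (block M i))
                    (cong₂ _,_ (trans (lookup-block M i _) (agrees i false))
                               (trans (lookup-block M i _) (agrees i true)))))

  selected-transfers : ∀ μ μ' M → Agrees μ M → Agrees μ' M →
                       ∀ i s → lookup μ (endpoint i s) ≡ just i → lookup μ' (endpoint i s) ≡ just i
  selected-transfers μ μ' M agrees agrees' i s eq =
    from-does (MaybeP.≡-dec FinP._≟_ _ _)
      (trans (sym (agrees' i s)) (trans (agrees i s) (dec-true (MaybeP.≡-dec FinP._≟_ _ _) eq)))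

  agreeing-selects : ∀ μ μ' M → ValidSelection E μ → Agrees μ M → Agrees μ' M →
                     ∀ {x i} → lookup μ x ≡ just i → lookup μ' x ≡ just i
  agreeing-selects μ μ' M valid agrees agrees' {x} {i} eq with valid x i eq
  ... | inj₁ e = subst (λ z → lookup μ' z ≡ just i) e
                   (selected-transfers μ μ' M agrees agrees' i false (subst (λ z → lookup μ z ≡ just i) (sym e) eq))
  ... | inj₂ e = subst (λ z → lookup μ' z ≡ just i) e
                   (selected-transfers μ μ' M agrees agrees' i true (subst (λ z → lookup μ z ≡ just i) (sym e) eq))

  agreeing-selection-unique : ∀ μ μ' M → ValidSelection E μ → ValidSelection E μ' →
                              Agrees μ M → Agrees μ' M → μ ≡ μ'
  agreeing-selection-unique μ μ' M valid valid' agrees agrees' =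
    trans (sym (VecP.tabulate∘lookup μ)) (trans (VecP.tabulate-cong same) (VecP.tabulate∘lookup μ'))
    where
    same : ∀ x → lookup μ x ≡ lookup μ' x
    same x with lookup μ x in eq | lookup μ' x in eq'
    ... | just i  | _       = trans (sym (agreeing-selects μ μ' M valid agrees agrees' eq)) eq'
    ... | nothing | just i  = trans (sym eq) (agreeing-selects μ' μ M valid' agrees' agrees eq')
    ... | nothing | nothing = refl

  extends : Selection n m → Vec Bool (m ℕ.* 6) → Bool
  extends μ M = does (validSelection? E μ) ∧ compatible (sideBits μ) M

  extends⁻ : ∀ μ M → extends μ M ≡ true → ValidSelection E μ × BlocksAdjacentFree M × Agrees μ M
  extends⁻ μ M ext =
    from-does (validSelection? E μ) (BoolP.∧-conicalˡ _ _ ext) , compatible⇒ μ M (BoolP.∧-conicalʳ _ _ ext)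

  module _ (loopless : ∀ i → proj₁ (E i) ≢ proj₂ (E i)) where

    endpoint-injective : ∀ i {s s'} → endpoint i s ≡ endpoint i s' → s ≡ s'
    endpoint-injective i {false} {false} _  = refl
    endpoint-injective i {false} {true}  eq = ⊥-elim (loopless i eq)
    endpoint-injective i {true}  {false} eq = ⊥-elim (loopless i (sym eq))
    endpoint-injective i {true}  {true}  _  = refl

    agrees⇒endEdgesDisjoint : ∀ μ M → Agrees μ M → EndEdgesDisjoint M
    agrees⇒endEdgesDisjoint μ M agrees i i' s s' meet p p' =
      i≡i' , endpoint-injective i' (trans (cong (λ z → endpoint z s) (sym i≡i')) meet)
      where
      selected : ∀ i s → lookup M (combine i (endPosition s)) ≡ true → lookup μ (endpoint i s) ≡ just i
      selected i s p = from-does (MaybeP.≡-dec FinP._≟_ _ _) (trans (sym (agrees i s)) p)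
      i≡i' : i ≡ i'
      i≡i' = MaybeP.just-injective (trans (sym (selected i s p)) (trans (cong (lookup μ) meet) (selected i' s' p')))

    module _ (M : Vec Bool (m ℕ.* 6)) (sep : EndEdgesDisjoint M) where

      Meets : Fin n → Fin m → Set
      Meets x i = Σ[ s ∈ Bool ] (Present M i (endPosition s) × endpoint i s ≡ x)

      meets? : ∀ x i → Dec (Meets x i)
      meets? x i with (lookup M (combine i (endPosition false)) BoolP.≟ true) ×-dec (endpoint i false FinP.≟ x)
                    | (lookup M (combine i (endPosition true))  BoolP.≟ true) ×-dec (endpoint i true  FinP.≟ x)
      ... | yes first | _          = yes (false , first)
      ... | no _      | yes second = yes (true , second)
      ... | no ¬first | no ¬second = no λ { (false , first) → ¬first first ; (true , second) → ¬second second }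

      meets-unique : ∀ {x i i'} → Meets x i → Meets x i' → i ≡ i'
      meets-unique (s , p , e) (s' , p' , e') = proj₁ (sep _ _ s s' (trans e (sym e')) p p')

      canonical : Fin n → Maybe (Fin m)
      canonical x with FinP.any? (meets? x)
      ... | yes (i , _) = just i
      ... | no _        = nothing

      canonical-just : ∀ x i → canonical x ≡ just i → Meets x i
      canonical-just x i eq with FinP.any? (meets? x)
      canonical-just x i refl | yes (_ , meets) = meets

      canonical-meets : ∀ x i → Meets x i → canonical x ≡ just i
      canonical-meets x i meets with FinP.any? (meets? x)
      ... | yes (j , meets') = cong just (meets-unique meets' meets)
      ... | no ¬meets        = ⊥-elim (¬meets (i , meets))

      canonicalSelection : Selection n m
      canonicalSelection = Vec.tabulate canonical

      canonicalSelection-valid : ValidSelection E canonicalSelection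
      canonicalSelection-valid x i eq with canonical-just x i (trans (sym (VecP.lookup∘tabulate canonical x)) eq)
      ... | false , _ , e = inj₁ e
      ... | true  , _ , e = inj₂ e

      canonicalSelection-agrees : Agrees canonicalSelection M
      canonicalSelection-agrees i s with lookup M (combine i (endPosition s)) in p
      ... | true  = sym (dec-true (MaybeP.≡-dec FinP._≟_ _ _)
                      (trans (VecP.lookup∘tabulate canonical _) (canonical-meets _ i (s , p , refl))))
      ... | false = sym (dec-false (MaybeP.≡-dec FinP._≟_ _ _) λ eq →
                      let (s' , p' , e) = canonical-just _ i (trans (sym (VecP.lookup∘tabulate canonical _)) eq)
                      in false≢true (trans (sym p) (subst (λ z → Present M i (endPosition z)) (endpoint-injective i e) p')))

    extends⇒matching : ∀ μ M → extends μ M ≡ true → IsMatching (ends6 E) M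
    extends⇒matching μ M ext =
      let (_ , free , agrees) = extends⁻ μ M ext
      in separated⇒matching M free (agrees⇒endEdgesDisjoint μ M agrees)

    matching⇒extended : ∀ M (isM : IsMatching (ends6 E) M) →
                        extends (canonicalSelection M (matching⇒endEdgesDisjoint M isM)) M ≡ true
    matching⇒extended M isM = cong₂ _∧_
      (dec-true (validSelection? E (canonicalSelection M sep)) (canonicalSelection-valid M sep))
      (compatible⇐ (canonicalSelection M sep) M (matching⇒blocksAdjacentFree M isM) (canonicalSelection-agrees M sep))
      where sep = matching⇒endEdgesDisjoint M isM

    extends-unique : ∀ {μ μ'} M → extends μ M ≡ true → extends μ' M ≡ true → μ ≡ μ'
    extends-unique {μ} {μ'} M ext ext' =
      let (valid , _ , agrees) = extends⁻ μ M ext ; (valid' , _ , agrees') = extends⁻ μ' M ext'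
      in agreeing-selection-unique μ μ' M valid valid' agrees agrees'

    -- A matching of sub(H,6) extends to exactly one valid selection, any other edge set to none.
    matching-indicator : ∀ M (isM? : Dec (IsMatching (ends6 E) M)) →
      [ does isM? ]× 1ℚ ≡ ∑ (selections n m) (λ μ → [ extends μ M ]× 1ℚ)
    matching-indicator M (yes isM) =
      sym (trans (∑-cong (selections n m) λ μ → cong (λ b → [ b ]× 1ℚ)
                    (≡-does (extends μ M) (VecP.≡-dec (MaybeP.≡-dec FinP._≟_) μ μ₀)
                            (λ ext → extends-unique M ext ext₀) (λ { refl → ext₀ })))
                 (selections-countsOnce n m μ₀))
      where
      μ₀ = canonicalSelection M (matching⇒endEdgesDisjoint M isM)
      ext₀ = matching⇒extended M isM
    matching-indicator M (no ¬isM) =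
      sym (trans (∑-cong (selections n m) λ μ → cong (λ b → [ b ]× 1ℚ)
                    (≡-does (extends μ M) (no ¬isM) (extends⇒matching μ M) (⊥-elim ∘ ¬isM)))
                 (∑-zero (selections n m)))

    ∑-matching-weights : ∀ ρ →
      PrMatching V6-dec (m ℕ.* 6) (ends6 E) (π6 {m} ρ)
        ≡ ∑ (selections n m) (λ μ → [ does (validSelection? E μ) ]×
                                     ∏ m (λ i → ½ * (½ * Λ ρ (proj₁ (sideBits μ i)) (proj₂ (sideBits μ i)))))
    ∑-matching-weights ρ = begin
      ∑ (filter matching? Ms) w
        ≡⟨ ∑-filter Ms matching? w ⟩
      ∑ Ms (λ M → [ does (matching? M) ]× w M)
        ≡⟨ ∑-cong Ms (λ M → trans (sym (guard-1ℚ-* (does (matching? M)) (w M)))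
                                  (cong (_* w M) (matching-indicator M (matching? M)))) ⟩
      ∑ Ms (λ M → ∑ μs (λ μ → [ extends μ M ]× 1ℚ) * w M)
        ≡⟨ ∑-cong Ms (λ M → ∑-*ʳ μs (w M) _) ⟩
      ∑ Ms (λ M → ∑ μs (λ μ → [ extends μ M ]× 1ℚ * w M))
        ≡⟨ ∑-comm Ms μs _ ⟩
      ∑ μs (λ μ → ∑ Ms (λ M → [ extends μ M ]× 1ℚ * w M))
        ≡⟨ ∑-cong μs (λ μ → ∑-cong Ms (λ M → trans (guard-1ℚ-* (extends μ M) (w M)) (guard-∧ (valid μ) _ (w M)))) ⟩
      ∑ μs (λ μ → ∑ Ms (λ M → [ valid μ ]× [ compatible (sideBits μ) M ]× w M))
        ≡⟨ ∑-cong μs (λ μ → ∑-guard Ms (valid μ) _) ⟩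
      ∑ μs (λ μ → [ valid μ ]× ∑ Ms (λ M → [ compatible (sideBits μ) M ]× w M))
        ≡⟨ ∑-cong μs (λ μ → cong ([ valid μ ]×_) (∑-compatible-weights ρ m (sideBits μ))) ⟩
      ∑ μs (λ μ → [ valid μ ]× ∏ m (λ i → ½ * (½ * Λ ρ (proj₁ (sideBits μ i)) (proj₂ (sideBits μ i))))) ∎
      where
      open ≡-Reasoning
      Ms = allVecs bools (m ℕ.* 6)
      μs = selections n m
      w = weight (π6 {m} ρ)
      matching? : ∀ M → Dec (IsMatching (ends6 E) M)
      matching? = isMatching? V6-dec (ends6 E)
      valid : Selection n m → Bool
      valid μ = does (validSelection? E μ)


-- Grouping selection functions by their types

monomial : (Bool → Bool → ℚ) → ℕ → ℕ → ℕ → ℕ → ℚ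
monomial f k₀₀ k₀₁ k₁₀ k₁₁ =
  powℚ (f false false) k₀₀ * (powℚ (f false true) k₀₁ * (powℚ (f true false) k₁₀ * powℚ (f true true) k₁₁))

module _ {A : Set} (f : Bool → Bool → ℚ) (t : A → Bool × Bool) where

  hasType? : ∀ b b' (x : A) → Dec ((proj₁ (t x) ≡ b) × (proj₂ (t x) ≡ b'))
  hasType? b b' x = (proj₁ (t x) BoolP.≟ b) ×-dec (proj₂ (t x) BoolP.≟ b')

  countType : Bool → Bool → List A → ℕ
  countType b b' xs = length (filter (hasType? b b') xs)

  private
    countType-∷ : ∀ b b' x xs →
      countType b b' (x ∷ xs) ≡ (if does (hasType? b b' x) then suc (countType b b' xs) else countType b b' xs)
    countType-∷ b b' x xs with does (hasType? b b' x)
    ... | true  = refl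
    ... | false = refl

    pw : List A → Bool → Bool → ℚ
    pw xs b b' = powℚ (f b b') (countType b b' xs)


    open +-*-Solver
    ×first : ∀ X a b c d → X * (a * (b * (c * d))) ≡ (X * a) * (b * (c * d))
    ×first = solve 5 (λ X a b c d → X :* (a :* (b :* (c :* d))) := (X :* a) :* (b :* (c :* d))) refl
    ×second : ∀ X a b c d → X * (a * (b * (c * d))) ≡ a * ((X * b) * (c * d))
    ×second = solve 5 (λ X a b c d → X :* (a :* (b :* (c :* d))) := a :* ((X :* b) :* (c :* d))) refl
    ×third : ∀ X a b c d → X * (a * (b * (c * d))) ≡ a * (b * ((X * c) * d))
    ×third = solve 5 (λ X a b c d → X :* (a :* (b :* (c :* d))) := a :* (b :* ((X :* c) :* d))) refl
    ×fourth : ∀ X a b c d → X * (a * (b * (c * d))) ≡ a * (b * (c * (X * d)))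
    ×fourth = solve 5 (λ X a b c d → X :* (a :* (b :* (c :* d))) := a :* (b :* (c :* (X :* d)))) refl

  prodℚ-by-type : ∀ xs → prodℚ (map (λ x → f (proj₁ (t x)) (proj₂ (t x))) xs)
    ≡ monomial f (countType false false xs) (countType false true xs) (countType true false xs) (countType true true xs)
  prodℚ-by-type []       = refl
  prodℚ-by-type (x ∷ xs)
    rewrite countType-∷ false false x xs | countType-∷ false true x xs
          | countType-∷ true false x xs  | countType-∷ true true x xs
    with t x
  ... | false , false =
    trans (cong (f false false *_) (prodℚ-by-type xs))
          (×first (f false false) (pw xs false false) (pw xs false true) (pw xs true false) (pw xs true true))
  ... | false , true  =
    trans (cong (f false true *_) (prodℚ-by-type xs))
          (×second (f false true) (pw xs false false) (pw xs false true) (pw xs true false) (pw xs true true))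
  ... | true  , false =
    trans (cong (f true false *_) (prodℚ-by-type xs))
          (×third (f true false) (pw xs false false) (pw xs false true) (pw xs true false) (pw xs true true))
  ... | true  , true  =
    trans (cong (f true true *_) (prodℚ-by-type xs))
          (×fourth (f true true) (pw xs false false) (pw xs false true) (pw xs true false) (pw xs true true))

∑-allτ : ∀ m (f : (Bool → Bool → Fin (suc m)) → ℚ) →
  ∑ (allτ m) f ≡ ∑ (allFin (suc m)) (λ a → ∑ (allFin (suc m)) (λ b →
                   ∑ (allFin (suc m)) (λ c → ∑ (allFin (suc m)) (λ d → f (mkτ a b c d)))))
∑-allτ m f =
  trans (∑-concatMap F (λ a → concatMap (λ b → concatMap (λ c → map (mkτ a b c) F) F) F) f) (∑-cong F λ a →
  trans (∑-concatMap F (λ b → concatMap (λ c → map (mkτ a b c) F) F) f) (∑-cong F λ b →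
  trans (∑-concatMap F (λ c → map (mkτ a b c) F) f) (∑-cong F λ c →
  ∑-map F (mkτ a b c) f)))
  where F = allFin (suc m)

matches? : ∀ {m} (k : Bool → Bool → ℕ) (τ : Bool → Bool → Fin (suc m)) →
           Dec ((k false false ≡ toℕ (τ false false)) × (k false true ≡ toℕ (τ false true)) ×
                (k true false ≡ toℕ (τ true false)) × (k true true ≡ toℕ (τ true true)))
matches? k τ = (k false false ℕ.≟ toℕ (τ false false)) ×-dec (k false true ℕ.≟ toℕ (τ false true)) ×-dec
               (k true false ℕ.≟ toℕ (τ true false)) ×-dec (k true true ℕ.≟ toℕ (τ true true))

∑-allτ-matches : ∀ m (k : Bool → Bool → ℕ) → (∀ b b' → k b b' ℕ.< suc m) → (g : ℕ → ℕ → ℕ → ℕ → ℚ) →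
  ∑ (allτ m) (λ τ → [ does (matches? k τ) ]×
                      g (toℕ (τ false false)) (toℕ (τ false true)) (toℕ (τ true false)) (toℕ (τ true true)))
    ≡ g (k false false) (k false true) (k true false) (k true true)
∑-allτ-matches m k bounded g = begin
  ∑ (allτ m) guarded
    ≡⟨ ∑-allτ m guarded ⟩
  ∑ F (λ a → ∑ F (λ b → ∑ F (λ c → ∑ F (λ d →
    [ k₀₀ ≐ a ∧ (k₀₁ ≐ b ∧ (k₁₀ ≐ c ∧ k₁₁ ≐ d)) ]× g (toℕ a) (toℕ b) (toℕ c) (toℕ d)))))
    ≡⟨ ∑-allFin-pick m k₀₀ (bounded false false)
         (λ t n → ∑ F (λ b → ∑ F (λ c → ∑ F (λ d →
                    [ t ∧ (k₀₁ ≐ b ∧ (k₁₀ ≐ c ∧ k₁₁ ≐ d)) ]× g n (toℕ b) (toℕ c) (toℕ d)))))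
         (λ _ → trans (∑-cong F (λ _ → trans (∑-cong F (λ _ → ∑-zero F)) (∑-zero F))) (∑-zero F)) ⟩
  ∑ F (λ b → ∑ F (λ c → ∑ F (λ d → [ k₀₁ ≐ b ∧ (k₁₀ ≐ c ∧ k₁₁ ≐ d) ]× g k₀₀ (toℕ b) (toℕ c) (toℕ d))))
    ≡⟨ ∑-allFin-pick m k₀₁ (bounded false true)
         (λ t n → ∑ F (λ c → ∑ F (λ d → [ t ∧ (k₁₀ ≐ c ∧ k₁₁ ≐ d) ]× g k₀₀ n (toℕ c) (toℕ d))))
         (λ _ → trans (∑-cong F (λ _ → ∑-zero F)) (∑-zero F)) ⟩
  ∑ F (λ c → ∑ F (λ d → [ k₁₀ ≐ c ∧ k₁₁ ≐ d ]× g k₀₀ k₀₁ (toℕ c) (toℕ d)))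
    ≡⟨ ∑-allFin-pick m k₁₀ (bounded true false)
         (λ t n → ∑ F (λ d → [ t ∧ k₁₁ ≐ d ]× g k₀₀ k₀₁ n (toℕ d))) (λ _ → ∑-zero F) ⟩
  ∑ F (λ d → [ k₁₁ ≐ d ]× g k₀₀ k₀₁ k₁₀ (toℕ d))
    ≡⟨ ∑-allFin-pick m k₁₁ (bounded true true) (λ t n → [ t ]× g k₀₀ k₀₁ k₁₀ n) (λ _ → refl) ⟩
  g k₀₀ k₀₁ k₁₀ k₁₁ ∎
  where
  open ≡-Reasoning
  F = allFin (suc m)
  guarded : (Bool → Bool → Fin (suc m)) → ℚ
  guarded τ = [ does (matches? k τ) ]× g (toℕ (τ false false)) (toℕ (τ false true)) (toℕ (τ true false)) (toℕ (τ true true))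
  _≐_ : ℕ → Fin (suc m) → Bool
  n ≐ a = does (n ℕ.≟ toℕ a)
  k₀₀ = k false false
  k₀₁ = k false true
  k₁₀ = k true false
  k₁₁ = k true true

typeCount-bounded : ∀ {n m} (E : Fin m → Fin n × Fin n) μ b b' → typeCount E μ b b' ℕ.< suc m
typeCount-bounded {m = m} E μ b b' =
  s≤s (ℕP.≤-trans (ListP.length-filter _ (allFin m)) (ℕP.≤-reflexive (ListP.length-tabulate id)))

module _ {n m : ℕ} (E : Fin m → Fin n × Fin n) (ρ : Bool → Bool → ℚ) where
  open SubdividedGraph E using (sideBits)

  ∑-rhsTerms : sumℚ (map (rhsTerm E ρ) (allτ m))
    ≡ ∑ (selections n m) (λ μ → [ does (validSelection? E μ) ]× ∏ m (λ i → Λ ρ (proj₁ (sideBits μ i)) (proj₂ (sideBits μ i))))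
  ∑-rhsTerms = begin
    ∑ τs (rhsTerm E ρ)
      ≡⟨ ∑-cong τs (λ τ → cong (_* mono τ) (ℕtoℚ-length-filter μs (inS? τ))) ⟩
    ∑ τs (λ τ → ∑ μs (λ μ → [ does (inS? τ μ) ]× 1ℚ) * mono τ)
      ≡⟨ ∑-cong τs (λ τ → trans (∑-*ʳ μs (mono τ) _) (∑-cong μs λ μ → guard-1ℚ-* (does (inS? τ μ)) (mono τ))) ⟩
    ∑ τs (λ τ → ∑ μs (λ μ → [ does (inS? τ μ) ]× mono τ))
      ≡⟨ ∑-comm τs μs _ ⟩
    ∑ μs (λ μ → ∑ τs (λ τ → [ valid μ ∧ does (matches? (typeCount E μ) τ) ]× mono τ))
      ≡⟨ ∑-cong μs (λ μ → trans (∑-cong τs λ τ → guard-∧ (valid μ) _ _) (∑-guard τs (valid μ) _)) ⟩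
    ∑ μs (λ μ → [ valid μ ]× ∑ τs (λ τ → [ does (matches? (typeCount E μ) τ) ]× mono τ))
      ≡⟨ ∑-cong μs (λ μ → cong ([ valid μ ]×_)
           (∑-allτ-matches m (typeCount E μ) (typeCount-bounded E μ) (monomial (Λ ρ)))) ⟩
    ∑ μs (λ μ → [ valid μ ]× monomial (Λ ρ) (typeCount E μ false false) (typeCount E μ false true)
                                            (typeCount E μ true false) (typeCount E μ true true))
      ≡⟨ ∑-cong μs (λ μ → cong ([ valid μ ]×_)
           (sym (trans (∏≡prodℚ m _) (prodℚ-by-type (Λ ρ) (sideBits μ) (allFin m))))) ⟩
    ∑ μs (λ μ → [ valid μ ]× ∏ m (λ i → Λ ρ (proj₁ (sideBits μ i)) (proj₂ (sideBits μ i)))) ∎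
    where
    open ≡-Reasoning
    τs = allτ m
    μs = selections n m
    valid : Selection n m → Bool
    valid μ = does (validSelection? E μ)
    inS? : ∀ τ μ → Dec _
    inS? τ μ = validSelection? E μ ×-dec matches? (typeCount E μ) τ
    mono : (Bool → Bool → Fin (suc m)) → ℚ
    mono τ = monomial (Λ ρ) (toℕ (τ false false)) (toℕ (τ false true)) (toℕ (τ true false)) (toℕ (τ true true))

powℚ-4^m-∏-quarters : ∀ m (x : Fin m → ℚ) → powℚ (ℕtoℚ 2) (2 ℕ.* m) * ∏ m (λ i → ½ * (½ * x i)) ≡ ∏ m x
powℚ-4^m-∏-quarters zero    x = refl
powℚ-4^m-∏-quarters (suc m) x = begin
  powℚ 2ℚ (suc m ℕ.+ (suc m ℕ.+ 0)) * (½ * (½ * x zero) * ∏ m (λ i → ½ * (½ * x (suc i))))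
    ≡⟨ cong (λ k → powℚ 2ℚ (suc k) * (½ * (½ * x zero) * ∏ m (λ i → ½ * (½ * x (suc i))))) (ℕP.+-suc m (m ℕ.+ 0)) ⟩
  2ℚ * (2ℚ * powℚ 2ℚ (2 ℕ.* m)) * (½ * (½ * x zero) * ∏ m (λ i → ½ * (½ * x (suc i))))
    ≡⟨ cancel-quarter (powℚ 2ℚ (2 ℕ.* m)) (x zero) _ ⟩
  x zero * (powℚ 2ℚ (2 ℕ.* m) * ∏ m (λ i → ½ * (½ * x (suc i))))
    ≡⟨ cong (x zero *_) (powℚ-4^m-∏-quarters m (x ∘ suc)) ⟩
  x zero * ∏ m (x ∘ suc) ∎
  where
  open ≡-Reasoning
  open +-*-Solver
  2ℚ = ℕtoℚ 2
  cancel-quarter : ∀ P y Q → 2ℚ * (2ℚ * P) * (½ * (½ * y) * Q) ≡ y * (P * Q)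
  cancel-quarter = solve 3 (λ P y Q → con 2ℚ :* (con 2ℚ :* P) :* ((con ½ :* (con ½ :* y)) :* Q) := y :* (P :* Q)) refl

fact6 : (n m : ℕ) (E : Fin m → Fin n × Fin n) → Simple E →
        (ρ : Bool → Bool → ℚ) → ((b b' : Bool) → (0ℚ ≤ ρ b b') × (ρ b b' ≤ 1ℚ)) →
        powℚ (ℕtoℚ 2) (2 ℕ.* m) * PrMatching V6-dec (m ℕ.* 6) (ends6 E) (π6 {m} ρ)
          ≡ sumℚ (map (rhsTerm E ρ) (allτ m))
fact6 n m E (loopless , _) ρ _ = begin
  4^m * PrMatching V6-dec (m ℕ.* 6) (ends6 E) (π6 {m} ρ)
    ≡⟨ cong (4^m *_) (SubdividedGraph.∑-matching-weights E loopless ρ) ⟩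
  4^m * ∑ μs (λ μ → [ valid μ ]× ∏ m (λ i → ½ * (½ * Λ' μ i)))
    ≡⟨ ∑-*ˡ μs 4^m _ ⟩
  ∑ μs (λ μ → 4^m * [ valid μ ]× ∏ m (λ i → ½ * (½ * Λ' μ i)))
    ≡⟨ ∑-cong μs (λ μ → trans (guard-*ˡ (valid μ) 4^m _) (cong ([ valid μ ]×_) (powℚ-4^m-∏-quarters m (Λ' μ)))) ⟩
  ∑ μs (λ μ → [ valid μ ]× ∏ m (Λ' μ))
    ≡⟨ ∑-rhsTerms E ρ ⟨
  sumℚ (map (rhsTerm E ρ) (allτ m)) ∎
  where
  open ≡-Reasoning
  open SubdividedGraph E using (sideBits)
  4^m = powℚ (ℕtoℚ 2) (2 ℕ.* m)
  μs = selections n m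
  valid : Selection n m → Bool
  valid μ = does (validSelection? E μ)
  Λ' : Selection n m → Fin m → ℚ
  Λ' μ i = Λ ρ (proj₁ (sideBits μ i)) (proj₂ (sideBits μ i))
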